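{- Let $G$ be a connected graph and $V_{\rm NT}\subseteq V(G)$. Then $G$ has a spanning tree in which every vertex of $V_{\rm NT}$ has degree at least $2$ if and only if the induced subgraph $G[N[V_{\rm NT}]]$ contains a forest (subgraph without cycles) in which every vertex of $V_{\rm NT}$ has degree at least $2$.
   Context: $N[X]=X\cup\{u : u \text{ adjacent to some } v\in X\}$ denotes the closed neighborhood of a vertex set $X$. -}

module Defs where

open import Data.Nat using (ℕ; _≤_)
open import Data.Fin using (Fin)
open import Data.Fin.Subset using (Subset; _∈_)
open import Data.Bool using (Bool; false; T)
open import Data.Bool.Properties using (T?)
open import Data.List using (List; []; _∷_; _++_; length; filter; allFin)
open import Data.List.Relation.Unary.Unique.Propositional using (Unique)
open import Data.Product using (Σ; _×_)
open import Data.Sum using (_⊎_)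
open import Data.Unit using (⊤)
open import Relation.Nullary using (¬_)
open import Relation.Binary.PropositionalEquality using (_≡_)

record Graph (n : ℕ) : Set where
  field
    adj    : Fin n → Fin n → Bool
    sym    : ∀ u v → adj u v ≡ adj v u
    irrefl : ∀ v → adj v v ≡ false
open Graph public

EdgeSet : ℕ → Set
EdgeSet n = Fin n → Fin n → Bool

IsSubgraph : ∀ {n} → Graph n → EdgeSet n → Set
IsSubgraph G E = (∀ u v → T (E u v) → T (adj G u v)) × (∀ u v → E u v ≡ E v u)

deg : ∀ {n} → EdgeSet n → Fin n → ℕ
deg {n} E v = length (filter (λ u → T? (E v u)) (allFin n))

data Walk {n} (E : EdgeSet n) : Fin n → Fin n → Set where
  here : ∀ {v} → Walk E v v
  step : ∀ {u w v} → T (E u w) → Walk E w v → Walk E u v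

Connected : ∀ {n} → EdgeSet n → Set
Connected {n} E = (u v : Fin n) → Walk E u v

Chain : ∀ {n} → EdgeSet n → List (Fin n) → Set
Chain E [] = ⊤
Chain E (x ∷ []) = ⊤
Chain E (x ∷ y ∷ r) = T (E x y) × Chain E (y ∷ r)

HasCycle : ∀ {n} → EdgeSet n → Set
HasCycle {n} E =
  Σ (Fin n) λ x → Σ (List (Fin n)) λ r →
    2 ≤ length r × Unique (x ∷ r) × Chain E ((x ∷ r) ++ (x ∷ []))

Acyclic : ∀ {n} → EdgeSet n → Set
Acyclic E = ¬ HasCycle E

IsSpanningTree : ∀ {n} → Graph n → EdgeSet n → Set
IsSpanningTree G E = IsSubgraph G E × Connected E × Acyclic E

ClosedNbhd : ∀ {n} → Graph n → Subset n → Fin n → Set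
ClosedNbhd {n} G X v = v ∈ X ⊎ Σ (Fin n) λ u → u ∈ X × T (adj G u v)

IsSubgraphOfInduced : ∀ {n} → Graph n → (Fin n → Set) → EdgeSet n → Set
IsSubgraphOfInduced G S E = IsSubgraph G E × (∀ u v → T (E u v) → S u × S v)

{-# OPTIONS --safe #-}
-- Restricting a spanning tree to the edges that meet V_NT gives a forest inside
-- G[N[V_NT]] with the same degrees on V_NT.  Conversely every forest of a connected
-- graph extends to a spanning tree, and extending only increases degrees: run
-- Kruskal's algorithm first on the edges of the forest, all of which it keeps since
-- none closes a cycle, and then on all edges of G.
module Submission where

open import Defs hiding (sym)
open import Level using (0ℓ)
open import Data.Nat using (ℕ; _≤_; z≤n; s≤s)
open import Data.Nat.Properties using (≤-trans)
open import Data.Fin using (Fin)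
open import Data.Fin.Properties using (_≟_)
open import Data.Fin.Subset using (Subset; _∈_)
open import Data.Fin.Subset.Properties using () renaming (_∈?_ to _∈ₛ?_)
open import Data.Bool using (false; T; _∧_; _∨_)
open import Data.Bool.Properties using (T?; T-∨; T-∧; ∨-comm)
open import Data.List using (List; []; _∷_; _++_; length; allFin; cartesianProduct; foldl)
open import Data.List.Relation.Unary.All using (All; []; _∷_; head)
open import Data.List.Relation.Unary.All.Properties using (¬Any⇒All¬)
open import Data.List.Relation.Unary.AllPairs using ([]; _∷_)
open import Data.List.Relation.Unary.Any using (here; there)
open import Data.List.Relation.Unary.Unique.Propositional using (Unique)
open import Data.List.Membership.Propositional using () renaming (_∈_ to _∈ₗ_)
open import Data.List.Membership.Propositional.Properties using (∈-allFin; ∈-cartesianProduct⁺)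
import Data.List.Membership.DecPropositional as DecMembership
open import Data.List.Relation.Binary.Sublist.Propositional using (⊆-refl)
open import Data.List.Relation.Binary.Sublist.Propositional.Properties using (filter⁺; length-mono-≤)
open import Data.Product using (Σ; ∃₂; _×_; _,_; proj₁; proj₂)
open import Data.Sum using (_⊎_; inj₁; inj₂; [_,_]′) renaming (map to map-⊎)
open import Data.Unit using (tt)
open import Data.Empty using (⊥; ⊥-elim)
open import Function using (_∘_)
open import Function.Bundles using (_⇔_; mk⇔; Equivalence)
open import Relation.Nullary using (¬_; Dec; yes; no; does)
open import Relation.Nullary.Decidable using (⌊_⌋; toWitness; fromWitness; isYes≗does; does-⇔; _×-dec_; _⊎-dec_)
open import Relation.Binary.Core using (Rel)
open import Relation.Binary.Definitions using (DecidableEquality)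
open import Relation.Binary.Construct.Union using (_∪_)
open import Relation.Binary.Construct.Closure.ReflexiveTransitive
  using (Star; ε; _◅_; _◅◅_; fold) renaming (map to map*)
open import Relation.Binary.PropositionalEquality using (_≡_; _≢_; refl; sym; trans; cong; cong₂; subst; module ≡-Reasoning)

open Equivalence using (to; from)

Edge : ∀ {n} → EdgeSet n → Rel (Fin n) 0ℓ
Edge E p q = T (E p q)

_⊆ₑ_ : ∀ {n} → EdgeSet n → EdgeSet n → Set
E ⊆ₑ E′ = ∀ {p q} → T (E p q) → T (E′ p q)

SymmetricEdges : ∀ {n} → EdgeSet n → Set
SymmetricEdges E = ∀ p q → E p q ≡ E q p

walk⇒star : ∀ {n} {E : EdgeSet n} {a b} → Walk E a b → Star (Edge E) a b
walk⇒star here       = ε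
walk⇒star (step e w) = e ◅ walk⇒star w

star⇒walk : ∀ {n} {E : EdgeSet n} {a b} → Star (Edge E) a b → Walk E a b
star⇒walk ε       = here
star⇒walk (e ◅ w) = step e (star⇒walk w)

constant-along-star : ∀ {A B : Set} {R : Rel A 0ℓ} (f : A → B) →
                      (∀ {p q} → R p q → f p ≡ f q) → ∀ {a b} → Star R a b → f a ≡ f b
constant-along-star f f-const = fold (λ a b → f a ≡ f b) (λ r eq → trans (f-const r) eq) refl

chain-mono : ∀ {n} {E E′ : EdgeSet n} → E ⊆ₑ E′ → ∀ xs → Chain E xs → Chain E′ xs
chain-mono E⊆E′ []          _        = tt
chain-mono E⊆E′ (x ∷ [])    _        = tt
chain-mono E⊆E′ (x ∷ y ∷ xs) (e , ch) = E⊆E′ e , chain-mono E⊆E′ (y ∷ xs) ch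

acyclic-mono : ∀ {n} {E E′ : EdgeSet n} → E′ ⊆ₑ E → Acyclic E → Acyclic E′
acyclic-mono E′⊆E acyclic (x , r , 2≤ , unique , ch) =
  acyclic (x , r , 2≤ , unique , chain-mono E′⊆E _ ch)

module Paths {A : Set} {R : Rel A 0ℓ} where

  vertices : ∀ {a b} → Star R a b → List A
  vertices {a} ε       = a ∷ []
  vertices {a} (_ ◅ w) = a ∷ vertices w

  1≤length-vertices : ∀ {a b} (w : Star R a b) → 1 ≤ length (vertices w)
  1≤length-vertices ε       = s≤s z≤n
  1≤length-vertices (_ ◅ _) = s≤s z≤n

  IsPath : ∀ {a b} → Star R a b → Set
  IsPath w = Unique (vertices w)

  suffix-from : ∀ {a b x} (w : Star R a b) → IsPath w → x ∈ₗ vertices w →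
                Σ (Star R x b) IsPath
  suffix-from ε       path       (here refl) = ε , path
  suffix-from (r ◅ w) path       (here refl) = r ◅ w , path
  suffix-from (_ ◅ w) (_ ∷ path) (there x∈w) = suffix-from w path x∈w

  module _ (_≟ᴬ_ : DecidableEquality A) where
    open DecMembership _≟ᴬ_ using (_∈?_)

    to-path : ∀ {a b} → Star R a b → Σ (Star R a b) IsPath
    to-path ε = ε , [] ∷ []
    to-path {a} (r ◅ w) with to-path w
    ... | p , path with a ∈? vertices p
    ...   | yes a∈p = suffix-from p path a∈p
    ...   | no  a∉p = r ◅ p , ¬Any⇒All¬ _ a∉p ∷ path

open Paths using (vertices; 1≤length-vertices; to-path)

chain-of-star : ∀ {n} {E : EdgeSet n} {a b c} {R′ : Rel (Fin n) 0ℓ} →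
                (∀ {p q} → R′ p q → T (E p q)) → (w : Star R′ a b) → T (E b c) →
                Chain E (vertices w ++ c ∷ [])
chain-of-star R′⊆E ε               e = e , tt
chain-of-star R′⊆E (r ◅ ε)         e = R′⊆E r , e , tt
chain-of-star R′⊆E (r ◅ r′ ◅ w)    e = R′⊆E r , chain-of-star R′⊆E (r′ ◅ w) e

module _ {A : Set} where

  Joins : A → A → Rel A 0ℓ
  Joins u v p q = (p ≡ u × q ≡ v) ⊎ (p ≡ v × q ≡ u)

  Joins-flip : ∀ {u v p q} → Joins u v p q → Joins u v q p
  Joins-flip (inj₁ (p≡u , q≡v)) = inj₂ (q≡v , p≡u)
  Joins-flip (inj₂ (p≡v , q≡u)) = inj₁ (q≡u , p≡v)

  Joins-swap : ∀ {u v p q} → Joins u v p q → Joins v u p q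
  Joins-swap (inj₁ eqs) = inj₂ eqs
  Joins-swap (inj₂ eqs) = inj₁ eqs

  Joins-same-pair : ∀ {u v a b p q} → Joins u v a b → Joins u v p q → Joins a b p q
  Joins-same-pair (inj₁ (refl , refl)) j = j
  Joins-same-pair (inj₂ (refl , refl)) j = Joins-swap j

  Joins-source : ∀ {u v p q} → Joins u v p q → p ≡ u ⊎ p ≡ v
  Joins-source = map-⊎ proj₁ proj₁

  Joins-target : ∀ {u v p q} → Joins u v p q → q ≡ u ⊎ q ≡ v
  Joins-target = [ inj₂ ∘ proj₂ , inj₁ ∘ proj₂ ]′

  ¬Joins-elsewhere : ∀ {u v p q} → u ≢ p → v ≢ p → ¬ Joins u v p q
  ¬Joins-elsewhere u≢p v≢p (inj₁ (refl , _)) = u≢p refl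
  ¬Joins-elsewhere u≢p v≢p (inj₂ (refl , _)) = v≢p refl

  joins? : DecidableEquality A → ∀ u v p q → Dec (Joins u v p q)
  joins? _≟ᴬ_ u v p q = (p ≟ᴬ u ×-dec q ≟ᴬ v) ⊎-dec (p ≟ᴬ v ×-dec q ≟ᴬ u)

  split-at-first-and-last : ∀ {R S : Rel A 0ℓ} {a b} → Star (R ∪ S) a b →
               Star R a b ⊎
               ((∃₂ λ p p′ → Star R a p × S p p′) × (∃₂ λ q′ q → S q′ q × Star R q b))
  split-at-first-and-last ε = inj₁ ε
  split-at-first-and-last (inj₁ r ◅ w) with split-at-first-and-last w
  ... | inj₁ w′                          = inj₁ (r ◅ w′)
  ... | inj₂ ((p , p′ , wp , s) , last) = inj₂ ((p , p′ , r ◅ wp , s) , last)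
  split-at-first-and-last (inj₂ s ◅ w) with split-at-first-and-last w
  ... | inj₁ w′         = inj₂ ((_ , _ , ε , s) , (_ , _ , s , w′))
  ... | inj₂ (_ , last) = inj₂ ((_ , _ , ε , s) , last)

module _ {n : ℕ} where

  Without : EdgeSet n → Fin n → Fin n → Rel (Fin n) 0ℓ
  Without E a b p q = T (E p q) × ¬ Joins a b p q

  EveryEdgeIsBridge : EdgeSet n → Set
  EveryEdgeIsBridge E = ∀ {a b} → T (E a b) → ¬ Star (Without E a b) a b

  acyclic⇒bridges : ∀ {E : EdgeSet n} → SymmetricEdges E → (∀ v → ¬ T (E v v)) →
                    Acyclic E → EveryEdgeIsBridge E
  acyclic⇒bridges {E} sym-E loopless acyclic {a} {b} e w with to-path _≟_ w
  ... | ε , _               = loopless a e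
  ... | r ◅ ε , _           = proj₂ r (inj₁ (refl , refl))
  ... | r ◅ r′ ◅ p , path =
    acyclic (a , vertices (r′ ◅ p) , s≤s (1≤length-vertices p) , path ,
             chain-of-star proj₁ (r ◅ r′ ◅ p) (subst T (sym-E a b) e))

  bridges⇒acyclic : ∀ {E : EdgeSet n} → SymmetricEdges E → EveryEdgeIsBridge E → Acyclic E
  bridges⇒acyclic sym-E bridges (x , [] , () , _)
  bridges⇒acyclic sym-E bridges (x , _ ∷ [] , s≤s () , _)
  bridges⇒acyclic {E} sym-E bridges
    (x , y ∷ r₁ ∷ r , _ , (x≢y ∷ x∉) ∷ (y≢r₁ ∷ y∉) ∷ _ , e-xy , e-yr₁ , ch) =
    bridges (subst T (sym-E x y) e-xy) (first ◅ back-to x∉ (y≢r₁ ∷ y∉) ch)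
    where
      first : Without E y x y r₁
      first = e-yr₁ , λ { (inj₁ (_ , r₁≡x)) → head x∉ (sym r₁≡x)
                        ; (inj₂ (y≡x , _))  → x≢y (sym y≡x) }

      back-to : ∀ {p} {ℓ : List (Fin n)} → All (x ≢_) (p ∷ ℓ) → All (y ≢_) (p ∷ ℓ) →
                Chain E (p ∷ ℓ ++ x ∷ []) → Star (Without E y x) p x
      back-to {ℓ = []}    (x≢p ∷ _)   (y≢p ∷ _)   (e , _)  =
        (e , ¬Joins-elsewhere y≢p x≢p) ◅ ε
      back-to {ℓ = _ ∷ _} (x≢p ∷ x∉) (y≢p ∷ y∉) (e , ch) =
        (e , ¬Joins-elsewhere y≢p x≢p) ◅ back-to x∉ y∉ ch

  connecting-subgraph-contains-bridge :
    ∀ {E F : EdgeSet n} {u v} → SymmetricEdges E → E ⊆ₑ F → EveryEdgeIsBridge F →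
    Star (Edge E) u v → T (F u v) → T (E u v)
  connecting-subgraph-contains-bridge {E} {F} {u} {v} sym-E E⊆F bridges w f with T? (E u v)
  ... | yes e = e
  ... | no ¬e = ⊥-elim (bridges f (map* avoid w))
    where
      avoid : ∀ {p q} → Edge E p q → Without F u v p q
      avoid e = E⊆F e , λ { (inj₁ (refl , refl)) → ¬e e
                          ; (inj₂ (refl , refl)) → ¬e (subst T (sym-E _ _) e) }

  addEdge : EdgeSet n → Fin n → Fin n → EdgeSet n
  addEdge E u v p q = E p q ∨ ⌊ joins? _≟_ u v p q ⌋

  module _ {E : EdgeSet n} {u v p q : Fin n} where

    addEdge-elim : T (addEdge E u v p q) → T (E p q) ⊎ Joins u v p q
    addEdge-elim t = map-⊎ (λ e → e) toWitness (to T-∨ t)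

    addEdge-old : T (E p q) → T (addEdge E u v p q)
    addEdge-old e = from (T-∨ {E p q}) (inj₁ e)

    addEdge-new : Joins u v p q → T (addEdge E u v p q)
    addEdge-new j = from (T-∨ {E p q}) (inj₂ (fromWitness j))

  addEdge-sym : ∀ {E : EdgeSet n} {u v} → SymmetricEdges E → SymmetricEdges (addEdge E u v)
  addEdge-sym {u = u} {v} sym-E p q =
    cong₂ _∨_ (sym-E p q) (begin
      ⌊ joins? _≟_ u v p q ⌋    ≡⟨ isYes≗does (joins? _≟_ u v p q) ⟩
      does (joins? _≟_ u v p q) ≡⟨ does-⇔ (mk⇔ Joins-flip Joins-flip) (joins? _≟_ u v p q) (joins? _≟_ u v q p) ⟩
      does (joins? _≟_ u v q p) ≡⟨ isYes≗does (joins? _≟_ u v q p) ⟨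
      ⌊ joins? _≟_ u v q p ⌋    ∎)
    where open ≡-Reasoning

  addEdge-⊆ : ∀ {E K : EdgeSet n} {u v} → SymmetricEdges K → E ⊆ₑ K → T (K u v) →
              addEdge E u v ⊆ₑ K
  addEdge-⊆ {E} {K} {u} {v} sym-K E⊆K k t with addEdge-elim {E} t
  ... | inj₁ e                    = E⊆K e
  ... | inj₂ (inj₁ (refl , refl)) = k
  ... | inj₂ (inj₂ (refl , refl)) = subst T (sym-K u v) k

  -- The state of Kruskal's algorithm: a forest together with a labelling of the
  -- vertices by representatives of their components.
  record LabelledForest : Set where
    field
      edges     : EdgeSet n
      label     : Fin n → Fin n
      symmetric : SymmetricEdges edges
      bridges   : EveryEdgeIsBridge edges
      edge⇒same-label : ∀ {a b} → T (edges a b) → label a ≡ label b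
      same-label⇒star : ∀ {a b} → label a ≡ label b → Star (Edge edges) a b

  empty : LabelledForest
  empty = record
    { edges = λ _ _ → false ; label = λ x → x ; symmetric = λ _ _ → refl
    ; bridges = λ () ; edge⇒same-label = λ () ; same-label⇒star = λ { refl → ε } }

  module Connect (s : LabelledForest) {u v : Fin n}
                 (distinct : LabelledForest.label s u ≢ LabelledForest.label s v) where
    open LabelledForest s

    merge : Fin n → Fin n
    merge ℓ with ℓ ≟ label v
    ... | yes _ = label u
    ... | no  _ = ℓ

    merge-cases : ∀ ℓ → (ℓ ≡ label v × merge ℓ ≡ label u) ⊎ (ℓ ≢ label v × merge ℓ ≡ ℓ)
    merge-cases ℓ with ℓ ≟ label v
    ... | yes ℓ≡v = inj₁ (ℓ≡v , refl)
    ... | no  ℓ≢v = inj₂ (ℓ≢v , refl)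

    merge-u : merge (label u) ≡ label u
    merge-u with merge-cases (label u)
    ... | inj₁ (u≡v , _) = ⊥-elim (distinct u≡v)
    ... | inj₂ (_ , eq)  = eq

    merge-v : merge (label v) ≡ label u
    merge-v with merge-cases (label v)
    ... | inj₁ (_ , eq)  = eq
    ... | inj₂ (v≢v , _) = ⊥-elim (v≢v refl)

    edges′ : EdgeSet n
    edges′ = addEdge edges u v

    old : edges ⊆ₑ edges′
    old = addEdge-old {edges}

    uv : T (edges′ u v)
    uv = addEdge-new {edges} (inj₁ (refl , refl))

    vu : T (edges′ v u)
    vu = addEdge-new {edges} (inj₂ (refl , refl))

    edge⇒same-label′ : ∀ {a b} → T (edges′ a b) → merge (label a) ≡ merge (label b)
    edge⇒same-label′ t with addEdge-elim {edges} t
    ... | inj₁ e                    = cong merge (edge⇒same-label e)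
    ... | inj₂ (inj₁ (refl , refl)) = trans merge-u (sym merge-v)
    ... | inj₂ (inj₂ (refl , refl)) = trans merge-v (sym merge-u)

    same-label⇒star′ : ∀ {a b} → merge (label a) ≡ merge (label b) → Star (Edge edges′) a b
    same-label⇒star′ {a} {b} eq with merge-cases (label a) | merge-cases (label b)
    ... | inj₁ (a≡v , _) | inj₁ (b≡v , _) = map* old (same-label⇒star (trans a≡v (sym b≡v)))
    ... | inj₁ (a≡v , ma) | inj₂ (_ , mb) =
      map* old (same-label⇒star a≡v) ◅◅
      vu ◅ map* old (same-label⇒star (trans (sym ma) (trans eq mb)))
    ... | inj₂ (_ , ma) | inj₁ (b≡v , mb) =
      map* old (same-label⇒star (trans (sym ma) (trans eq mb))) ◅◅
      uv ◅ map* old (same-label⇒star (sym b≡v))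
    ... | inj₂ (_ , ma) | inj₂ (_ , mb) = map* old (same-label⇒star (trans (sym ma) (trans eq mb)))

    avoid-new : ∀ {a b} → Joins u v a b → ∀ {p q} → Without edges′ a b p q → T (edges p q)
    avoid-new j (t , ¬j) with addEdge-elim {edges} t
    ... | inj₁ e  = e
    ... | inj₂ j′ = ⊥-elim (¬j (Joins-same-pair j j′))

    old-or-new : ∀ {a b p q} → Without edges′ a b p q → (Without edges a b ∪ Joins u v) p q
    old-or-new (t , ¬j) = map-⊎ (_, ¬j) (λ j → j) (addEdge-elim {edges} t)

    label-along : ∀ {a b x y} → Star (Without edges a b) x y → label x ≡ label y
    label-along = constant-along-star label (edge⇒same-label ∘ proj₁)

    new-edge-is-bridge : ∀ {a b} → Joins u v a b → ¬ Star (Without edges′ a b) a b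
    new-edge-is-bridge j@(inj₁ (refl , refl)) w =
      distinct (constant-along-star label edge⇒same-label (map* (avoid-new j) w))
    new-edge-is-bridge j@(inj₂ (refl , refl)) w =
      distinct (sym (constant-along-star label edge⇒same-label (map* (avoid-new j) w)))

    -- A detour around an old edge ab through the new edge leaves and re-enters
    -- {u, v}: at the same vertex it shortcuts to an old detour, at different ones
    -- it would force label u ≡ label v.
    old-edge-is-bridge : ∀ {a b} → T (edges a b) → ¬ Star (Without edges′ a b) a b
    old-edge-is-bridge {a} {b} e w with split-at-first-and-last (map* old-or-new w)
    ... | inj₁ w′ = bridges e w′
    ... | inj₂ ((_ , _ , wp , jp) , (_ , _ , jq , wq)) =
      reenter (Joins-source jp) (Joins-target jq) wp wq
      where
        reenter : ∀ {p q} → p ≡ u ⊎ p ≡ v → q ≡ u ⊎ q ≡ v →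
                  Star (Without edges a b) a p → Star (Without edges a b) q b → ⊥
        reenter (inj₁ refl) (inj₁ refl) wp wq = bridges e (wp ◅◅ wq)
        reenter (inj₂ refl) (inj₂ refl) wp wq = bridges e (wp ◅◅ wq)
        reenter (inj₁ refl) (inj₂ refl) wp wq =
          distinct (trans (sym (label-along wp)) (trans (edge⇒same-label e) (sym (label-along wq))))
        reenter (inj₂ refl) (inj₁ refl) wp wq =
          distinct (trans (label-along wq) (trans (sym (edge⇒same-label e)) (label-along wp)))

    bridges′ : EveryEdgeIsBridge edges′
    bridges′ t = [ old-edge-is-bridge , new-edge-is-bridge ]′ (addEdge-elim {edges} t)

    forest : LabelledForest
    forest = record
      { edges = edges′ ; label = merge ∘ label ; symmetric = addEdge-sym symmetric
      ; bridges = bridges′ ; edge⇒same-label = edge⇒same-label′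
      ; same-label⇒star = same-label⇒star′ }

  open LabelledForest

  same-label-mono : ∀ (s s′ : LabelledForest) → edges s ⊆ₑ edges s′ →
                    ∀ {a b} → label s a ≡ label s b → label s′ a ≡ label s′ b
  same-label-mono s s′ s⊆s′ eq =
    constant-along-star (label s′) (edge⇒same-label s′) (map* s⊆s′ (same-label⇒star s eq))

  insert : EdgeSet n → LabelledForest → Fin n × Fin n → LabelledForest
  insert H s (u , v) with T? (H u v)
  ... | no _ = s
  ... | yes _ with label s u ≟ label s v
  ...   | yes _       = s
  ...   | no distinct = Connect.forest s distinct

  insert-⊇ : ∀ H s e → edges s ⊆ₑ edges (insert H s e)
  insert-⊇ H s (u , v) with T? (H u v)
  ... | no _ = λ e → e
  ... | yes _ with label s u ≟ label s v
  ...   | yes _       = λ e → e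
  ...   | no distinct = Connect.old s distinct

  insert-⊆ : ∀ {H K : EdgeSet n} s e → SymmetricEdges K → H ⊆ₑ K → edges s ⊆ₑ K →
             edges (insert H s e) ⊆ₑ K
  insert-⊆ {H} s (u , v) sym-K H⊆K s⊆K with T? (H u v)
  ... | no _ = s⊆K
  ... | yes h with label s u ≟ label s v
  ...   | yes _       = s⊆K
  ...   | no distinct = addEdge-⊆ sym-K s⊆K (H⊆K h)

  insert-joins : ∀ H s {u v} → T (H u v) →
                 label (insert H s (u , v)) u ≡ label (insert H s (u , v)) v
  insert-joins H s {u} {v} h with T? (H u v)
  ... | no ¬h = ⊥-elim (¬h h)
  ... | yes _ with label s u ≟ label s v
  ...   | yes same    = same
  ...   | no distinct = Connect.edge⇒same-label′ s distinct (Connect.uv s distinct)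

  run : EdgeSet n → LabelledForest → List (Fin n × Fin n) → LabelledForest
  run H = foldl (insert H)

  run-⊇ : ∀ H s es → edges s ⊆ₑ edges (run H s es)
  run-⊇ H s []       e′ = e′
  run-⊇ H s (e ∷ es) e′ = run-⊇ H (insert H s e) es (insert-⊇ H s e e′)

  run-⊆ : ∀ {H K : EdgeSet n} s es → SymmetricEdges K → H ⊆ₑ K → edges s ⊆ₑ K →
          edges (run H s es) ⊆ₑ K
  run-⊆ s []       sym-K H⊆K s⊆K = s⊆K
  run-⊆ {H} s (e ∷ es) sym-K H⊆K s⊆K =
    run-⊆ (insert H s e) es sym-K H⊆K (insert-⊆ s e sym-K H⊆K s⊆K)

  run-joins : ∀ H s es {u v} → (u , v) ∈ₗ es → T (H u v) →
              label (run H s es) u ≡ label (run H s es) v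
  run-joins H s (e ∷ es) (here refl) h =
    same-label-mono (insert H s e) (run H (insert H s e) es) (run-⊇ H (insert H s e) es)
                    (insert-joins H s h)
  run-joins H s (e ∷ es) (there uv∈es) h = run-joins H (insert H s e) es uv∈es h

  allPairs : List (Fin n × Fin n)
  allPairs = cartesianProduct (allFin n) (allFin n)

  saturate : EdgeSet n → LabelledForest → LabelledForest
  saturate H s = run H s allPairs

  saturate-joins : ∀ H s {u v} → T (H u v) → label (saturate H s) u ≡ label (saturate H s) v
  saturate-joins H s {u} {v} = run-joins H s allPairs (∈-cartesianProduct⁺ (∈-allFin u) (∈-allFin v))

open LabelledForest

forest-extends-to-spanning-tree :
  ∀ {n} (G : Graph n) → Connected (adj G) → {F : EdgeSet n} → IsSubgraph G F → Acyclic F →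
  Σ (EdgeSet n) λ Tr → IsSpanningTree G Tr × F ⊆ₑ Tr
forest-extends-to-spanning-tree {n} G connected {F} (F⊆G , sym-F) acyclic-F =
  edges tree ,
  (((λ _ _ → tree⊆G) , symmetric tree) , spanning , bridges⇒acyclic (symmetric tree) (bridges tree)) ,
  F⊆tree
  where
    bridges-F : EveryEdgeIsBridge F
    bridges-F = acyclic⇒bridges sym-F (λ v f → subst T (irrefl G v) (F⊆G v v f)) acyclic-F

    seeded : LabelledForest
    seeded = saturate F empty

    seeded⊆F : edges seeded ⊆ₑ F
    seeded⊆F = run-⊆ empty allPairs sym-F (λ f → f) (λ ())

    F⊆seeded : F ⊆ₑ edges seeded
    F⊆seeded f = connecting-subgraph-contains-bridge (symmetric seeded) seeded⊆F bridges-F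
                   (same-label⇒star seeded (saturate-joins F empty f)) f

    tree : LabelledForest
    tree = saturate (adj G) seeded

    tree⊆G : edges tree ⊆ₑ adj G
    tree⊆G = run-⊆ seeded allPairs (Graph.sym G) (λ g → g) (λ e → F⊆G _ _ (seeded⊆F e))

    F⊆tree : F ⊆ₑ edges tree
    F⊆tree f = run-⊇ (adj G) seeded allPairs (F⊆seeded f)

    spanning : Connected (edges tree)
    spanning a b = star⇒walk (same-label⇒star tree
      (constant-along-star (label tree) (saturate-joins (adj G) seeded) (walk⇒star (connected a b))))

deg-mono : ∀ {n} (E E′ : EdgeSet n) {v} → (∀ {u} → T (E v u) → T (E′ v u)) → deg E v ≤ deg E′ v
deg-mono {n} E E′ {v} E⊆E′ =
  length-mono-≤ (filter⁺ (λ u → T? (E v u)) (λ u → T? (E′ v u)) (λ { refl → E⊆E′ })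
                         (⊆-refl {x = allFin n}))

module _ {n : ℕ} where

  incidentTo : EdgeSet n → Subset n → EdgeSet n
  incidentTo E X p q = E p q ∧ (⌊ p ∈ₛ? X ⌋ ∨ ⌊ q ∈ₛ? X ⌋)

  module _ (E : EdgeSet n) (X : Subset n) where

    incidentTo-⊆ : incidentTo E X ⊆ₑ E
    incidentTo-⊆ {p} {q} t = proj₁ (to (T-∧ {E p q}) t)

    incidentTo-endpoint : ∀ {p q} → T (incidentTo E X p q) → p ∈ X ⊎ q ∈ X
    incidentTo-endpoint {p} {q} t =
      map-⊎ (toWitness {a? = p ∈ₛ? X}) (toWitness {a? = q ∈ₛ? X})
            (to (T-∨ {⌊ p ∈ₛ? X ⌋}) (proj₂ (to (T-∧ {E p q}) t)))

    incidentTo-at : ∀ {v u} → v ∈ X → T (E v u) → T (incidentTo E X v u)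
    incidentTo-at {v} {u} v∈X e =
      from (T-∧ {E v u}) (e , from (T-∨ {⌊ v ∈ₛ? X ⌋}) (inj₁ (fromWitness v∈X)))

    incidentTo-sym : SymmetricEdges E → SymmetricEdges (incidentTo E X)
    incidentTo-sym sym-E p q = cong₂ _∧_ (sym-E p q) (∨-comm ⌊ p ∈ₛ? X ⌋ ⌊ q ∈ₛ? X ⌋)

    incidentTo-acyclic : Acyclic E → Acyclic (incidentTo E X)
    incidentTo-acyclic = acyclic-mono incidentTo-⊆

    incidentTo-deg : ∀ {v} → v ∈ X → deg E v ≤ deg (incidentTo E X) v
    incidentTo-deg v∈X = deg-mono E (incidentTo E X) (incidentTo-at v∈X)

    incidentTo-in-closedNbhd : (G : Graph n) → IsSubgraph G E →
                               IsSubgraphOfInduced G (ClosedNbhd G X) (incidentTo E X)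
    incidentTo-in-closedNbhd G (E⊆G , sym-E) =
      ((λ p q → E⊆G p q ∘ incidentTo-⊆) , incidentTo-sym sym-E) ,
      λ p q t → ends (incidentTo-endpoint t) (E⊆G p q (incidentTo-⊆ t))
      where
        ends : ∀ {p q} → p ∈ X ⊎ q ∈ X → T (adj G p q) → ClosedNbhd G X p × ClosedNbhd G X q
        ends {p} {q} (inj₁ p∈X) g = inj₁ p∈X , inj₂ (p , p∈X , g)
        ends {p} {q} (inj₂ q∈X) g = inj₂ (q , q∈X , subst T (Graph.sym G p q) g) , inj₁ q∈X

lemma2 : (n : ℕ) (G : Graph n) → Connected (adj G) → (VNT : Subset n) →
    (Σ (EdgeSet n) λ T → IsSpanningTree G T × (∀ v → v ∈ VNT → 2 ≤ deg T v))
    ⇔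
    (Σ (EdgeSet n) λ F → IsSubgraphOfInduced G (ClosedNbhd G VNT) F × Acyclic F
    × (∀ v → v ∈ VNT → 2 ≤ deg F v))
lemma2 n G connected VNT = mk⇔
  (λ (Tr , (Tr⊆G , _ , acyclic) , deg≥2) →
     incidentTo Tr VNT , incidentTo-in-closedNbhd Tr VNT G Tr⊆G , incidentTo-acyclic Tr VNT acyclic ,
     λ v v∈ → ≤-trans (deg≥2 v v∈) (incidentTo-deg Tr VNT v∈))
  (λ (F , (F⊆G , _) , acyclic , deg≥2) →
     let (Tr , spanning-tree , F⊆Tr) = forest-extends-to-spanning-tree G connected F⊆G acyclic
     in Tr , spanning-tree , λ v v∈ → ≤-trans (deg≥2 v v∈) (deg-mono F Tr F⊆Tr))
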